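{- Let $V$ be a finite non-empty set and $T:\mathscr{P}(V)\to\mathscr{P}(V)$ a map, and let $R$ and $S$ be the relations defined below. If $(E_1,E_2)$ is a pair of equivalence relations on $V$ with $T(X)=\mathbf{l}_{E_2}(\mathbf{l}_{E_1}(X))$ for all $X\subseteq V$, then $E_2\subseteq R$ and $E_1\subseteq S$ (as sets of pairs, i.e. $E_2$ is finer than $R$ and $E_1$ is finer than $S$).
   Context: For an equivalence relation $E$ on $V$: $\mathbf{l}_E(X)=\{x:[x]_E\subseteq X\}$. Let $J$ be the range of $T$; $a\sim_R b$ iff for every $X\in J$, $a\in X\Leftrightarrow b\in X$. When $T$ admits such a pair $(E_1,E_2)$, for each non-empty $Y\in J$ the family $\{X:T(X)=Y\}$ has a least element $Y_m$ w.r.t. $\subseteq$ (a separate result); with $K=\{Y_m: Y\in J,Y\neq\emptyset\}$, $a\sim_S b$ iff for every $X\in K$, $a\in X\Leftrightarrow b\in X$. -}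

module Defs where

open import Level using (0ℓ)
open import Data.Nat using (ℕ)
open import Data.Fin using (Fin)
open import Data.Fin.Subset using (Subset; _∈_; _⊆_; Nonempty)
open import Data.Product using (Σ; ∃; _×_)
open import Function.Bundles using (_⇔_)
open import Relation.Binary.Core using (Rel)
open import Relation.Binary.PropositionalEquality using (_≡_)

-- The finite set V is Fin n; subsets of V are  Subset n  (Vec Bool n).

lower : ∀ {n} → Rel (Fin n) 0ℓ → (Fin n → Set) → (Fin n → Set)
lower E P x = ∀ y → E x y → P y

mem : ∀ {n} → Subset n → Fin n → Set
mem X x = x ∈ X

InRange : ∀ {n} → (Subset n → Subset n) → Subset n → Set
InRange T Y = ∃ λ X → T X ≡ Y

RelR : ∀ {n} → (Subset n → Subset n) → Rel (Fin n) 0ℓ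
RelR T a b = ∀ Y → InRange T Y → (a ∈ Y ⇔ b ∈ Y)

IsLeastPreimage : ∀ {n} → (Subset n → Subset n) → Subset n → Subset n → Set
IsLeastPreimage T Y X = (T X ≡ Y) × (∀ X' → T X' ≡ Y → X ⊆ X')

InK : ∀ {n} → (Subset n → Subset n) → Subset n → Set
InK T X = ∃ λ Y → InRange T Y × Nonempty Y × IsLeastPreimage T Y X

RelS : ∀ {n} → (Subset n → Subset n) → Rel (Fin n) 0ℓ
RelS T a b = ∀ X → InK T X → (a ∈ X ⇔ b ∈ X)

-- Every set l_E(P) is a union of E-classes. Hence the sets in the range of
-- T = l_{E₂} ∘ l_{E₁} never separate E₂-related points. For E₁: if a lies in
-- a least preimage X while some E₁-neighbour b of a does not, then no E₁-class
-- contained in X meets a, so X - a has the same E₁-lower approximation, and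
-- therefore the same image under T, as X — contradicting minimality.
module Submission where

open import Defs
open import Level using (0ℓ)
open import Data.Nat using (ℕ; suc)
open import Data.Fin using (Fin)
open import Data.Fin.Subset using (Subset; _∈_; _∉_; _⊆_; _-_; ⁅_⁆)
open import Data.Fin.Subset.Properties
  using (_∈?_; ⊆-antisym; p─q⊆p; x∈p∧x≢y⇒x∈p-y; x∈p⇒p-x⊂p)
open import Data.Product using (_×_; _,_)
open import Function.Bundles using (_⇔_; mk⇔; Equivalence)
open import Relation.Binary.Core using (Rel)
open import Relation.Binary.Definitions using (Transitive)
open import Relation.Binary.Structures using (IsEquivalence)
open import Relation.Binary.PropositionalEquality using (_≡_; refl; trans)
open import Relation.Nullary using (yes; no; contradiction)

open Equivalence using (to; from)

module _ {n} {E : Rel (Fin n) 0ℓ} where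

  lower-mono : ∀ {P Q : Fin n → Set} → (∀ {x} → P x → Q x)
    → ∀ {x} → lower E P x → lower E Q x
  lower-mono P⊆Q x∈lP y xEy = P⊆Q (x∈lP y xEy)

  lower-closed : Transitive E → ∀ {P : Fin n → Set} {a b}
    → E a b → lower E P a → lower E P b
  lower-closed E-trans aEb a∈lP y bEy = a∈lP y (E-trans aEb bEy)

  lower-remove : Transitive E → ∀ {X a b} → E a b → b ∉ X
    → ∀ {y} → lower E (mem X) y → lower E (mem (X - a)) y
  lower-remove E-trans {b = b} aEb b∉X y∈lX z yEz =
    x∈p∧x≢y⇒x∈p-y (y∈lX z yEz) λ { refl → b∉X (y∈lX b (E-trans yEz aEb)) }

module _ {n} (T : Subset n → Subset n) (E₁ E₂ : Rel (Fin n) 0ℓ)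
  (T-def : ∀ X x → (x ∈ T X ⇔ lower E₂ (lower E₁ (mem X)) x)) where

  T-mono-lower : ∀ {X X'} → (∀ {x} → lower E₁ (mem X) x → lower E₁ (mem X') x)
    → T X ⊆ T X'
  T-mono-lower {X} {X'} l⊆l' {x} x∈TX =
    from (T-def X' x) (lower-mono {E = E₂} l⊆l' (to (T-def X x) x∈TX))

  T-closed : Transitive E₂ → ∀ {X a b} → E₂ a b → a ∈ T X → b ∈ T X
  T-closed E₂-trans {X} {a} {b} aEb a∈TX =
    from (T-def X b) (lower-closed E₂-trans aEb (to (T-def X a) a∈TX))

  E₂⊆RelR : IsEquivalence E₂ → ∀ a b → E₂ a b → RelR T a b
  E₂⊆RelR E₂-equiv a b aEb _ (X , refl) =
    mk⇔ (T-closed E₂.trans aEb) (T-closed E₂.trans (E₂.sym aEb))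
    where module E₂ = IsEquivalence E₂-equiv

  T-remove : Transitive E₁ → ∀ {X a b} → E₁ a b → b ∉ X → T (X - a) ≡ T X
  T-remove E₁-trans {X} {a} aEb b∉X = ⊆-antisym
    (T-mono-lower (lower-mono {E = E₁} (p─q⊆p X ⁅ a ⁆)))
    (T-mono-lower (lower-remove E₁-trans aEb b∉X))

  leastPreimage-closed : Transitive E₁ → ∀ {X Y a b} → E₁ a b
    → IsLeastPreimage T Y X → a ∈ X → b ∈ X
  leastPreimage-closed E₁-trans {X} {a = a} {b} aEb (TX≡Y , least) a∈X
    with b ∈? X | x∈p⇒p-x⊂p a∈X
  ... | yes b∈X | _                     = b∈X
  ... | no  b∉X | (_ , x , x∈X , x∉X-a) = contradiction (X⊆X-a x∈X) x∉X-a
    where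
    X⊆X-a : X ⊆ X - a
    X⊆X-a = least (X - a) (trans (T-remove E₁-trans aEb b∉X) TX≡Y)

  E₁⊆RelS : IsEquivalence E₁ → ∀ a b → E₁ a b → RelS T a b
  E₁⊆RelS E₁-equiv a b aEb X (_ , _ , _ , least) =
    mk⇔ (leastPreimage-closed E₁.trans aEb least)
        (leastPreimage-closed E₁.trans (E₁.sym aEb) least)
    where module E₁ = IsEquivalence E₁-equiv

mainTheorem5 : (m : ℕ) → (T : Subset (suc m) → Subset (suc m))
    → (E₁ E₂ : Rel (Fin (suc m)) 0ℓ)
    → IsEquivalence E₁ → IsEquivalence E₂
    → (∀ X x → (x ∈ T X ⇔ lower E₂ (lower E₁ (mem X)) x))
    → (∀ a b → E₂ a b → RelR T a b) × (∀ a b → E₁ a b → RelS T a b)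
mainTheorem5 m T E₁ E₂ E₁-equiv E₂-equiv T-def =
  E₂⊆RelR T E₁ E₂ T-def E₂-equiv , E₁⊆RelS T E₁ E₂ T-def E₁-equiv
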